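{- Let $n\ge 3$ and let $C_n\circ K_1$ be the corona of the cycle $C_n$ with $K_1$ (the graph obtained from $C_n$ by attaching one new pendant vertex to each vertex of the cycle), which has $2n$ vertices. Then there exists a bijection $f:V(C_n\circ K_1)\to\{1,\dots,2n\}$ such that the endpoints of every edge receive labels of opposite parity (i.e., the all-negative signed $C_n\circ K_1$ is a parity signed graph) if and only if $n$ is even.
   Context: A signed graph $S=(G,\sigma)$ with $N=|V(G)|$ is a parity signed graph if there exists a bijection $f:V(G)\to\{1,\dots,N\}$ such that every edge $uv$ has $\sigma(uv)=+$ when $f(u),f(v)$ have the same parity and $\sigma(uv)=-$ otherwise. For graphs $J,K$, the corona $J\circ K$ is formed from one copy of $J$ and $|V(J)|$ copies of $K$ by joining every vertex of the $i$-th copy of $K$ to the $i$-th vertex of $J$. -}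

module Defs where

open import Data.Nat using (ℕ; suc; _+_; _%_)
open import Data.Fin using (Fin; toℕ)
open import Data.Sum using (_⊎_; inj₁; inj₂)
open import Data.Empty using (⊥)
open import Data.Unit using (⊤)
open import Data.Product using (∃; _×_)
open import Relation.Binary.PropositionalEquality using (_≡_)
open import Function.Bundles using (_⤖_; _⇔_; Bijection)

record Graph (V : Set) : Set₁ where
  field
    Adj : V → V → Set

data Sign : Set where
  plus minus : Sign

-- Parity of a label i ∈ {1,…,N}, with the label represented by k : Fin N as i = toℕ k + 1.
labelParity : ∀ {N} → Fin N → ℕ
labelParity k = (toℕ k + 1) % 2

IsParitySigned : {V : Set} (N : ℕ) (G : Graph V) (σ : V → V → Sign) → Set
IsParitySigned {V} N G σ =
  ∃ λ (f : V ⤖ Fin N) → ∀ u v → Graph.Adj G u v →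
    (σ u v ≡ plus × labelParity (Bijection.to f u) ≡ labelParity (Bijection.to f v))
    ⊎ (σ u v ≡ minus × ¬same (Bijection.to f u) (Bijection.to f v))
  where
  ¬same : Fin N → Fin N → Set
  ¬same a b = labelParity a ≡ labelParity b → ⊥

allNegative : {V : Set} → V → V → Sign
allNegative _ _ = minus

succMod : (n : ℕ) → ℕ → ℕ → Set
succMod n i j = (j ≡ i + 1) ⊎ ((i + 1 ≡ n) × (j ≡ 0))

cycleAdj : (n : ℕ) → Fin n → Fin n → Set
cycleAdj n i j = succMod n (toℕ i) (toℕ j) ⊎ succMod n (toℕ j) (toℕ i)

-- The corona C_n ∘ K_1: vertices inj₁ i (cycle vertex i) and inj₂ i (pendant vertex
-- attached to cycle vertex i); 2n vertices in total.
coronaCycleK1 : (n : ℕ) → Graph (Fin n ⊎ Fin n)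
coronaCycleK1 n = record { Adj = adj }
  where
  adj : Fin n ⊎ Fin n → Fin n ⊎ Fin n → Set
  adj (inj₁ i) (inj₁ j) = cycleAdj n i j
  adj (inj₁ i) (inj₂ j) = i ≡ j
  adj (inj₂ i) (inj₁ j) = i ≡ j
  adj (inj₂ i) (inj₂ j) = ⊥

-- In an all-negative signed graph, a labelling is a parity labelling exactly when the label
-- parities form a proper 2-colouring. A proper 2-colouring of C_n alternates along the path
-- 0, 1, …, n−1, so the closing edge (n−1, 0) forces n to be even. Conversely, for even n,
-- colour cycle vertex i by the parity of i and its pendant vertex by the opposite parity, and
-- give this pair the labels 2i+1 and 2i+2 in the order prescribed by the colours.
module Submission where

open import Defs
open import Data.Nat using (ℕ; zero; suc; _≤_; _+_; _*_; _%_; _<_; s≤s; z≤n; parity)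
open import Data.Nat.Properties using (+-comm; +-assoc; *-comm; +-identityʳ; n<1+n; <-trans)
open import Data.Parity.Base as ℙ using (Parity; 0ℙ; 1ℙ; _⁻¹)
open import Data.Parity.Properties as ℙ using (p≢p⁻¹; +-homo-+; *-homo-*)
open import Data.Fin using (Fin; zero; suc; toℕ; fromℕ<; cast; combine)
open import Data.Fin.Properties using (toℕ-fromℕ<; toℕ-cast; toℕ-combine; cast-involutive; *↔×)
open import Data.Sum using (_⊎_; inj₁; inj₂; [_,_])
open import Data.Product using (∃; _×_; _,_)
open import Data.Product.Function.NonDependent.Propositional using (_×-↔_)
open import Function using (_∘_)
open import Function.Bundles using (_⇔_; mk⇔; Equivalence; _↔_; mk↔ₛ′; _⤖_; Bijection; Inverse)
open import Function.Construct.Composition using (_↔-∘_)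
open import Function.Construct.Symmetry using (↔-sym)
open import Function.Construct.Identity using (↔-id)
open import Function.Properties.Inverse using (↔⇒⤖)
open import Relation.Nullary using (contradiction)
open import Relation.Binary.PropositionalEquality
  using (_≡_; _≢_; refl; sym; trans; cong; module ≡-Reasoning)

%2≡⇔parity≡ : ∀ m n → m % 2 ≡ n % 2 ⇔ parity m ≡ parity n
%2≡⇔parity≡ 0 0 = mk⇔ (λ _ → refl) (λ _ → refl)
%2≡⇔parity≡ 0 1 = mk⇔ (λ ()) (λ ())
%2≡⇔parity≡ 1 0 = mk⇔ (λ ()) (λ ())
%2≡⇔parity≡ 1 1 = mk⇔ (λ _ → refl) (λ _ → refl)
%2≡⇔parity≡ 0 (suc (suc n)) = %2≡⇔parity≡ 0 n
%2≡⇔parity≡ 1 (suc (suc n)) = %2≡⇔parity≡ 1 n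
%2≡⇔parity≡ (suc (suc m)) n = %2≡⇔parity≡ m n

parity-suc : ∀ n → parity (suc n) ≡ parity n ⁻¹
parity-suc n = +-homo-+ 1 n

parity-+1 : ∀ n → parity (n + 1) ≡ parity n ⁻¹
parity-+1 n = trans (cong parity (+-comm n 1)) (parity-suc n)

parity-2*m+n : ∀ m n → parity (2 * m + n) ≡ parity n
parity-2*m+n m n = begin
  parity (2 * m + n)            ≡⟨ +-homo-+ (2 * m) n ⟩
  parity (2 * m) ℙ.+ parity n   ≡⟨ cong (ℙ._+ parity n) (*-homo-* 2 m) ⟩
  parity n                      ∎
  where open ≡-Reasoning

≢⇒≡⁻¹ : ∀ {p q} → p ≢ q → q ≡ p ⁻¹
≢⇒≡⁻¹ {0ℙ} {0ℙ} p≢q = contradiction refl p≢q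
≢⇒≡⁻¹ {0ℙ} {1ℙ} _   = refl
≢⇒≡⁻¹ {1ℙ} {0ℙ} _   = refl
≢⇒≡⁻¹ {1ℙ} {1ℙ} p≢q = contradiction refl p≢q

≡⁻¹⇒≢ : ∀ {p q} → q ≡ p ⁻¹ → p ≢ q
≡⁻¹⇒≢ {p} refl = p≢p⁻¹ p

IsProperColouring : {V : Set} → (V → V → Set) → (V → Parity) → Set
IsProperColouring Adj c = ∀ u v → Adj u v → c u ≢ c v

labelParityℙ : ∀ {N} → Fin N → Parity
labelParityℙ k = parity (toℕ k + 1)

labelParity≡⇔ : ∀ {N} (k l : Fin N) →
  labelParity k ≡ labelParity l ⇔ labelParityℙ k ≡ labelParityℙ l
labelParity≡⇔ k l = %2≡⇔parity≡ (toℕ k + 1) (toℕ l + 1)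

allNegative-parity-signed⇔ : ∀ {V : Set} N (G : Graph V) →
  IsParitySigned N G allNegative ⇔
  ∃ λ (f : V ⤖ Fin N) → IsProperColouring (Graph.Adj G) (labelParityℙ ∘ Bijection.to f)
allNegative-parity-signed⇔ N G = mk⇔
  (λ (f , signed) → f , λ u v uv →
    oppositeLabels {Bijection.to f u} {Bijection.to f v} (signed u v uv))
  (λ (f , proper) → f , λ u v uv → inj₂ (refl ,
    proper u v uv ∘ Equivalence.to (labelParity≡⇔ (Bijection.to f u) (Bijection.to f v))))
  where
  oppositeLabels : ∀ {k l : Fin N} →
    (minus ≡ plus × labelParity k ≡ labelParity l) ⊎
    (minus ≡ minus × labelParity k ≢ labelParity l) →
    labelParityℙ k ≢ labelParityℙ l
  oppositeLabels (inj₁ (() , _))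
  oppositeLabels {k} {l} (inj₂ (_ , labels≢)) = labels≢ ∘ Equivalence.from (labelParity≡⇔ k l)

p+q≢q⇒p≡1ℙ : ∀ {p q} → p ℙ.+ q ≢ q → p ≡ 1ℙ
p+q≢q⇒p≡1ℙ {0ℙ} p+q≢q = contradiction refl p+q≢q
p+q≢q⇒p≡1ℙ {1ℙ} _     = refl

cycleAdj-suc : ∀ {n k} (k<n : k < n) (k+1<n : suc k < n) →
  cycleAdj n (fromℕ< k<n) (fromℕ< k+1<n)
cycleAdj-suc {k = k} k<n k+1<n = inj₁ (inj₁ (begin
  toℕ (fromℕ< k+1<n)    ≡⟨ toℕ-fromℕ< k+1<n ⟩
  suc k                 ≡⟨ +-comm 1 k ⟩
  k + 1                 ≡⟨ cong (_+ 1) (toℕ-fromℕ< k<n) ⟨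
  toℕ (fromℕ< k<n) + 1  ∎))
  where open ≡-Reasoning

cycleAdj-last : ∀ m → cycleAdj (suc m) (fromℕ< (n<1+n m)) zero
cycleAdj-last m = inj₁ (inj₂ (trans (cong (_+ 1) (toℕ-fromℕ< (n<1+n m))) (+-comm m 1) , refl))

proper-cycle-alternates : ∀ {m} (c : Fin (suc m) → Parity) →
  IsProperColouring (cycleAdj (suc m)) c →
  ∀ k (k<n : k < suc m) → c (fromℕ< k<n) ≡ parity k ℙ.+ c zero
proper-cycle-alternates c proper zero (s≤s z≤n) = refl
proper-cycle-alternates c proper (suc k) k+1<n = begin
  c (fromℕ< k+1<n)             ≡⟨ ≢⇒≡⁻¹ (proper _ _ (cycleAdj-suc k<n k+1<n)) ⟩
  c (fromℕ< k<n) ⁻¹            ≡⟨ cong _⁻¹ (proper-cycle-alternates c proper k k<n) ⟩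
  1ℙ ℙ.+ (parity k ℙ.+ c zero)  ≡⟨ ℙ.+-assoc 1ℙ (parity k) (c zero) ⟨
  parity k ⁻¹ ℙ.+ c zero        ≡⟨ cong (ℙ._+ c zero) (parity-suc k) ⟨
  parity (suc k) ℙ.+ c zero     ∎
  where
  open ≡-Reasoning
  k<n = <-trans (n<1+n k) k+1<n

cycle-proper⇒even : ∀ n (c : Fin n → Parity) →
  IsProperColouring (cycleAdj n) c → parity n ≡ 0ℙ
cycle-proper⇒even zero    c proper = refl
cycle-proper⇒even (suc m) c proper = begin
  parity (suc m)  ≡⟨ parity-suc m ⟩
  parity m ⁻¹     ≡⟨ cong _⁻¹ (p+q≢q⇒p≡1ℙ closingEdge) ⟩
  0ℙ              ∎
  where
  open ≡-Reasoning
  closingEdge : parity m ℙ.+ c zero ≢ c zero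
  closingEdge rewrite sym (proper-cycle-alternates c proper m (n<1+n m)) =
    proper _ _ (cycleAdj-last m)

succMod⇒parity≡⁻¹ : ∀ {n i j} → parity n ≡ 0ℙ → succMod n i j → parity j ≡ parity i ⁻¹
succMod⇒parity≡⁻¹ {i = i} _ (inj₁ refl) = parity-+1 i
succMod⇒parity≡⁻¹ {n} {i} n-even (inj₂ (i+1≡n , refl)) = begin
  0ℙ               ≡⟨ n-even ⟨
  parity n         ≡⟨ cong parity i+1≡n ⟨
  parity (i + 1)   ≡⟨ parity-+1 i ⟩
  parity i ⁻¹      ∎
  where open ≡-Reasoning

even-cycle-proper : ∀ {n} → parity n ≡ 0ℙ → IsProperColouring (cycleAdj n) (parity ∘ toℕ)
even-cycle-proper n-even i j (inj₁ i→j) = ≡⁻¹⇒≢ (succMod⇒parity≡⁻¹ n-even i→j)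
even-cycle-proper n-even i j (inj₂ j→i) = ≡⁻¹⇒≢ (succMod⇒parity≡⁻¹ n-even j→i) ∘ sym

coronaColouring : ∀ {n} → (Fin n → Parity) → Fin n ⊎ Fin n → Parity
coronaColouring c = [ c , _⁻¹ ∘ c ]

coronaColouring-proper : ∀ {n} (c : Fin n → Parity) → IsProperColouring (cycleAdj n) c →
  IsProperColouring (Graph.Adj (coronaCycleK1 n)) (coronaColouring c)
coronaColouring-proper c proper (inj₁ i) (inj₁ j) i~j  = proper i j i~j
coronaColouring-proper c proper (inj₁ i) (inj₂ .i) refl = p≢p⁻¹ (c i)
coronaColouring-proper c proper (inj₂ i) (inj₁ .i) refl = p≢p⁻¹ (c i) ∘ sym

IsProperColouring-resp : ∀ {V : Set} {Adj : V → V → Set} {c d : V → Parity} →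
  (∀ v → c v ≡ d v) → IsProperColouring Adj d → IsProperColouring Adj c
IsProperColouring-resp c≗d proper u v uv cu≡cv =
  proper u v uv (trans (sym (c≗d u)) (trans cu≡cv (c≗d v)))

⊎↔×Parity : {A : Set} → (A ⊎ A) ↔ (A × Parity)
⊎↔×Parity = mk↔ₛ′ to from (λ { (a , 0ℙ) → refl ; (a , 1ℙ) → refl })
                          (λ { (inj₁ a) → refl ; (inj₂ a) → refl })
  where
  to : _ ⊎ _ → _ × Parity
  to (inj₁ a) = a , 0ℙ
  to (inj₂ a) = a , 1ℙ
  from : _ × Parity → _ ⊎ _
  from (a , 0ℙ) = inj₁ a
  from (a , 1ℙ) = inj₂ a

shiftBy : {A : Set} → (A → Parity) → (A × Parity) ↔ (A × Parity)
shiftBy c = mk↔ₛ′ shift shift involutive involutive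
  where
  shift : _ × Parity → _ × Parity
  shift (a , p) = a , p ℙ.+ c a
  involutive : ∀ x → shift (shift x) ≡ x
  involutive (a , p) = cong (a ,_) (begin
    (p ℙ.+ c a) ℙ.+ c a  ≡⟨ ℙ.+-assoc p (c a) (c a) ⟩
    p ℙ.+ (c a ℙ.+ c a)  ≡⟨ cong (p ℙ.+_) (ℙ.p+p≡0ℙ (c a)) ⟩
    p ℙ.+ 0ℙ             ≡⟨ ℙ.+-identityʳ p ⟩
    p                    ∎)
    where open ≡-Reasoning

-- Labels 2i+1 (odd) and 2i+2 (even) sit at positions 0 and 1 of the i-th block of two.
offsetOfLabelParity : Parity ↔ Fin 2
offsetOfLabelParity = mk↔ₛ′ to from (λ { zero → refl ; (suc zero) → refl })
                                    (λ { 0ℙ → refl ; 1ℙ → refl })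
  where
  to : Parity → Fin 2
  to 1ℙ = zero
  to 0ℙ = suc zero
  from : Fin 2 → Parity
  from zero       = 1ℙ
  from (suc zero) = 0ℙ

castFin↔ : ∀ {m n} → m ≡ n → Fin m ↔ Fin n
castFin↔ m≡n = mk↔ₛ′ (cast m≡n) (cast (sym m≡n)) (cast-involutive m≡n (sym m≡n))
                     (cast-involutive (sym m≡n) m≡n)

n*2≡n+n : ∀ n → n * 2 ≡ n + n
n*2≡n+n n = trans (*-comm n 2) (cong (n +_) (+-identityʳ n))

blockLabelling : ∀ n → (Fin n × Parity) ↔ Fin (n + n)
blockLabelling n =
  castFin↔ (n*2≡n+n n) ↔-∘ (↔-sym *↔× ↔-∘ (↔-id (Fin n) ×-↔ offsetOfLabelParity))

blockLabelling-parity : ∀ n (i : Fin n) p →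
  labelParityℙ (Inverse.to (blockLabelling n) (i , p)) ≡ p
blockLabelling-parity n i p = begin
  parity (toℕ (cast _ (combine i offset)) + 1)
    ≡⟨ cong (parity ∘ (_+ 1)) (trans (toℕ-cast _ (combine i offset)) (toℕ-combine i offset)) ⟩
  parity (2 * toℕ i + toℕ offset + 1)
    ≡⟨ cong parity (+-assoc (2 * toℕ i) (toℕ offset) 1) ⟩
  parity (2 * toℕ i + (toℕ offset + 1))
    ≡⟨ parity-2*m+n (toℕ i) (toℕ offset + 1) ⟩
  parity (toℕ offset + 1)
    ≡⟨ offset-parity p ⟩
  p ∎
  where
  open ≡-Reasoning
  offset : Fin 2
  offset = Inverse.to offsetOfLabelParity p
  offset-parity : ∀ p → parity (toℕ (Inverse.to offsetOfLabelParity p) + 1) ≡ p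
  offset-parity 0ℙ = refl
  offset-parity 1ℙ = refl

coronaLabelling : ∀ {n} → (Fin n → Parity) → (Fin n ⊎ Fin n) ↔ Fin (n + n)
coronaLabelling {n} c = blockLabelling n ↔-∘ (shiftBy c ↔-∘ ⊎↔×Parity)

coronaLabelling-parity : ∀ {n} (c : Fin n → Parity) v →
  labelParityℙ (Inverse.to (coronaLabelling c) v) ≡ coronaColouring c v
coronaLabelling-parity {n} c (inj₁ i) = blockLabelling-parity n i (c i)
coronaLabelling-parity {n} c (inj₂ i) = blockLabelling-parity n i (c i ⁻¹)

cycle-proper⇒corona-labelling : ∀ {n} (c : Fin n → Parity) →
  IsProperColouring (cycleAdj n) c →
  ∃ λ (f : (Fin n ⊎ Fin n) ⤖ Fin (n + n)) →
    IsProperColouring (Graph.Adj (coronaCycleK1 n)) (labelParityℙ ∘ Bijection.to f)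
cycle-proper⇒corona-labelling c proper =
  ↔⇒⤖ (coronaLabelling c) ,
  IsProperColouring-resp (coronaLabelling-parity c) (coronaColouring-proper c proper)

mainTheorem11 : (n : ℕ) → 3 ≤ n →
    IsParitySigned (n + n) (coronaCycleK1 n) allNegative ⇔ (n % 2 ≡ 0)
mainTheorem11 n _ = mk⇔ onlyIfEven ifEven
  where
  signed⇔proper : IsParitySigned (n + n) (coronaCycleK1 n) allNegative ⇔
    ∃ λ (f : (Fin n ⊎ Fin n) ⤖ Fin (n + n)) →
      IsProperColouring (Graph.Adj (coronaCycleK1 n)) (labelParityℙ ∘ Bijection.to f)
  signed⇔proper = allNegative-parity-signed⇔ (n + n) (coronaCycleK1 n)
  n%2⇔parity : n % 2 ≡ 0 ⇔ parity n ≡ 0ℙ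
  n%2⇔parity = %2≡⇔parity≡ n 0

  onlyIfEven : IsParitySigned (n + n) (coronaCycleK1 n) allNegative → n % 2 ≡ 0
  onlyIfEven signed with Equivalence.to signed⇔proper signed
  ... | f , proper = Equivalence.from n%2⇔parity (cycle-proper⇒even n
    (labelParityℙ ∘ Bijection.to f ∘ inj₁) (λ i j → proper (inj₁ i) (inj₁ j)))

  ifEven : n % 2 ≡ 0 → IsParitySigned (n + n) (coronaCycleK1 n) allNegative
  ifEven n-even = Equivalence.from signed⇔proper (cycle-proper⇒corona-labelling
    (parity ∘ toℕ) (even-cycle-proper (Equivalence.to n%2⇔parity n-even)))
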